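{- Let $d\ge1$ and $n>d$ be integers and let $T_1\subset\{1,\dots,n\}$ be such that $\{T_1\}\in L(n,d)$. Then $\mathcal{I}_{n,d}(\{T_1\})$ is isomorphic, as a poset, to $L(n-|T_1|,\,d-|T_1|)$.
   Context: For a finite set $X$ put $\operatorname{codim}_d(X)=d+1-|X|$. For a finite collection $\{T_1,\dots,T_l\}$ of pairwise distinct finite sets put $\rho_d(\{T_1,\dots,T_l\})=\sum_{i=1}^l\operatorname{codim}_d(T_i)$ (with $\rho_d(\emptyset)=0$) and $D_d(\{T_1,\dots,T_l\})=\operatorname{codim}_d(T_1\cap\cdots\cap T_l)-\rho_d(\{T_1,\dots,T_l\})$. For integers $d\ge1$, $n>d$, let $L(n,d)$ be the set of all $T\subset 2^{\{1,\dots,n\}}$ such that (1) $D_d(T')>0$ for every $T'\subset T$ with $|T'|>1$, and (2) $0\le |T_i|\le d$ for every $T_i\in T$. It is partially ordered by: $T<T'$ iff $\rho_d(T)<\rho_d(T')$ and for every $T_i\in T$ there exists $T'_j\in T'$ with $T'_j\subset T_i$; $T\le T'$ means $T<T'$ or $T=T'$. For $d=0$ (and any $n>0$), $L(n,0)$ is the two-element poset $\{\emptyset,\{\emptyset\}\}$ with $\emptyset<\{\emptyset\}$. For $T\in L(n,d)$, $\mathcal{I}_{n,d}(T)=\{S\in L(n,d): S\le T\}$. -}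

module Defs where

open import Data.Nat as ℕ using (ℕ; zero; suc; _∸_)
open import Data.Integer as ℤ using (ℤ; +_; _-_; _+_)
open import Data.Bool using (Bool; true; false)
open import Data.Vec using ([]; _∷_)
open import Data.Fin.Subset using (Subset; _∩_; ⊤; ∣_∣; _⊆_; inside; outside)
open import Data.List as List using (List; map; _++_; length; foldr)
open import Data.List.Membership.Propositional using (_∈_)
open import Data.Product using (Σ; ∃; _×_; _,_; proj₁)
open import Data.Sum using (_⊎_)
open import Relation.Binary.PropositionalEquality using (_≡_)

-- A finite collection of (pairwise distinct) subsets of {1,…,n}
-- (represented as subsets of Fin n), encoded canonically as a binary
-- trie: Coll 0 says whether ∅ is a member; Coll (suc n) = (members
-- not containing element 0 , members containing element 0).
Coll : ℕ → Set
Coll zero = Bool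
Coll (suc n) = Coll n × Coll n

members : ∀ {n} → Coll n → List (Subset n)
members {zero} true = [] List.∷ List.[]
members {zero} false = List.[]
members {suc n} (A , B) = map (outside ∷_) (members A) ++ map (inside ∷_) (members B)

_∈C_ : ∀ {n} → Subset n → Coll n → Set
X ∈C C = X ∈ members C

_⊆C_ : ∀ {n} → Coll n → Coll n → Set
S ⊆C T = ∀ X → X ∈C S → X ∈C T

size : ∀ {n} → Coll n → ℕ
size C = length (members C)

emptyC : ∀ {n} → Coll n
emptyC {zero} = false
emptyC {suc n} = emptyC , emptyC

single : ∀ {n} → Subset n → Coll n
single {zero} [] = true
single {suc n} (false ∷ X) = single X , emptyC
single {suc n} (true ∷ X) = emptyC , single X

codim : ∀ {n} → ℕ → Subset n → ℤ
codim d X = + suc d - + ∣ X ∣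

ρ : ∀ {n} → ℕ → Coll n → ℤ
ρ d C = foldr (λ X r → codim d X + r) (+ 0) (members C)

⋂ : ∀ {n} → Coll n → Subset n
⋂ C = foldr _∩_ ⊤ (members C)

D : ∀ {n} → ℕ → Coll n → ℤ
D d C = codim d (⋂ C) - ρ d C

record InL (n d : ℕ) (C : Coll n) : Set where
  field
    cond1 : ∀ C' → C' ⊆C C → 1 ℕ.< size C' → + 0 ℤ.< D d C'
    cond2 : ∀ X → X ∈C C → ∣ X ∣ ℕ.≤ d

_<[_]_ : ∀ {n} → Coll n → ℕ → Coll n → Set
S <[ d ] S' = ρ d S ℤ.< ρ d S' × (∀ X → X ∈C S → ∃ λ Y → Y ∈C S' × Y ⊆ X)

_≤[_]_ : ∀ {n} → Coll n → ℕ → Coll n → Set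
S ≤[ d ] S' = S <[ d ] S' ⊎ S ≡ S'

Lelt : ℕ → ℕ → Set
Lelt n d = Σ (Coll n) (InL n d)

Ielt : (n d : ℕ) → Coll n → Set
Ielt n d T = Σ (Coll n) λ S → InL n d S × S ≤[ d ] T

record PosetIso (n d : ℕ) (T : Coll n) (m e : ℕ) : Set where
  field
    to      : Ielt n d T → Lelt m e
    from    : Lelt m e → Ielt n d T
    from∘to : ∀ x → proj₁ (from (to x)) ≡ proj₁ x
    to∘from : ∀ y → proj₁ (to (from y)) ≡ proj₁ y
    mono    : ∀ x x' → proj₁ x ≤[ d ] proj₁ x' → proj₁ (to x) ≤[ e ] proj₁ (to x')
    reflect : ∀ x x' → proj₁ (to x) ≤[ e ] proj₁ (to x') → proj₁ x ≤[ d ] proj₁ x'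

module Submission where

-- Write F = {1..n} ∖ T.  A subset Y ⊆ F gives the superset  embed T Y = T ∪ Y
-- of T, and  codim_d(T ∪ Y) = codim_{d-|T|}(Y)  since |T ∪ Y| = |T| + |Y|.
-- Lifting a collection C on F member-wise gives  lift T C,  a bijection
-- (inverse: restrict T) onto the collections all of whose members contain T;
-- it preserves ⊆, sizes and intersections and shifts codim, ρ, D from
-- d - |T| to d.
-- Hence restrict T and lift T are mutually inverse order isomorphisms.

open import Defs
open import Data.Nat using (ℕ; _≤_; _<_; _∸_)
open import Data.Fin.Subset using (Subset; ∣_∣)

open import Data.Nat as ℕ using (zero; suc; _+_; z≤n; s≤s)
import Data.Nat.Properties as ℕP
open import Data.Integer as ℤ using (ℤ; +_; _⊖_; +<+)
import Data.Integer.Properties as ℤP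
open import Data.Bool using (true; false)
open import Data.Vec using ([]; _∷_; here)
import Data.Vec.Properties as VecP
open import Data.Fin.Subset using (_∩_; ⊤; ⊥; _⊆_; inside; outside)
open import Data.Fin.Subset.Properties
  using (drop-∷-⊆; out⊆; in⊆in; ⊆-refl; ⊆-reflexive; ⊆-antisym; ∣p∣≤n; ∣⊥∣≡0)
open import Data.List using (List; []; _∷_; map; _++_; length; foldr)
import Data.List.Properties as ListP
open import Data.List.Membership.Propositional using (_∈_)
open import Data.List.Membership.Propositional.Properties
  using (∈-map⁺; ∈-map⁻; ∈-++⁺ˡ; ∈-++⁺ʳ)
open import Data.List.Relation.Unary.Any using (here)
open import Data.Product using (Σ; ∃; _×_; _,_; proj₁; proj₂)
open import Data.Sum using (_⊎_; inj₁; inj₂; map₂) renaming (map to map-⊎)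
open import Function using (_∘_)
open import Relation.Nullary using (¬_; yes; no; contradiction)
open import Relation.Binary.PropositionalEquality

-- Subsets containing T, parametrised by subsets of the complement of T.

free : ∀ {n} → Subset n → ℕ
free [] = 0
free (outside ∷ T) = suc (free T)
free (inside ∷ T) = free T

free≡n∸∣T∣ : ∀ {n} (T : Subset n) → free T ≡ n ∸ ∣ T ∣
free≡n∸∣T∣ [] = refl
free≡n∸∣T∣ (outside ∷ T) = trans (cong suc (free≡n∸∣T∣ T)) (sym (ℕP.+-∸-assoc 1 (∣p∣≤n T)))
free≡n∸∣T∣ (inside ∷ T) = free≡n∸∣T∣ T

-- embed T Y = T ∪ Y, where Y ⊆ {1..n} ∖ T is indexed by the free positions.
embed : ∀ {n} (T : Subset n) → Subset (free T) → Subset n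
embed [] Y = Y
embed (outside ∷ T) (b ∷ Y) = b ∷ embed T Y
embed (inside ∷ T) Y = inside ∷ embed T Y

cons-⊆ : ∀ {m n b c} {X Y : Subset m} {P Q : Subset n} →
         (b ∷ X) ⊆ (c ∷ Y) → P ⊆ Q → (b ∷ P) ⊆ (c ∷ Q)
cons-⊆ {b = outside} _ P⊆Q = out⊆ P⊆Q
cons-⊆ {b = inside} {c = inside} _ P⊆Q = in⊆in P⊆Q
cons-⊆ {b = inside} {c = outside} X⊆Y _ = contradiction (X⊆Y here) λ ()

embed-⊆ : ∀ {n} (T : Subset n) {X Y} → X ⊆ Y → embed T X ⊆ embed T Y
embed-⊆ [] X⊆Y = X⊆Y
embed-⊆ (outside ∷ T) {_ ∷ _} {_ ∷ _} X⊆Y = cons-⊆ X⊆Y (embed-⊆ T (drop-∷-⊆ X⊆Y))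
embed-⊆ (inside ∷ T) X⊆Y = in⊆in (embed-⊆ T X⊆Y)

embed-⊆⁻ : ∀ {n} (T : Subset n) {X Y} → embed T X ⊆ embed T Y → X ⊆ Y
embed-⊆⁻ [] eX⊆eY = eX⊆eY
embed-⊆⁻ (outside ∷ T) {_ ∷ _} {_ ∷ _} eX⊆eY = cons-⊆ eX⊆eY (embed-⊆⁻ T (drop-∷-⊆ eX⊆eY))
embed-⊆⁻ (inside ∷ T) eX⊆eY = embed-⊆⁻ T (drop-∷-⊆ eX⊆eY)

embed-injective : ∀ {n} (T : Subset n) {X Y} → embed T X ≡ embed T Y → X ≡ Y
embed-injective T eq =
  ⊆-antisym (embed-⊆⁻ T (⊆-reflexive eq)) (embed-⊆⁻ T (⊆-reflexive (sym eq)))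

T⊆embed : ∀ {n} (T : Subset n) Y → T ⊆ embed T Y
T⊆embed [] [] = ⊆-refl
T⊆embed (outside ∷ T) (_ ∷ Y) = out⊆ (T⊆embed T Y)
T⊆embed (inside ∷ T) Y = in⊆in (T⊆embed T Y)

embed-⊤ : ∀ {n} (T : Subset n) → embed T ⊤ ≡ ⊤
embed-⊤ [] = refl
embed-⊤ (outside ∷ T) = cong (inside ∷_) (embed-⊤ T)
embed-⊤ (inside ∷ T) = cong (inside ∷_) (embed-⊤ T)

embed-∩ : ∀ {n} (T : Subset n) X Y → embed T (X ∩ Y) ≡ embed T X ∩ embed T Y
embed-∩ [] X Y = refl
embed-∩ (outside ∷ T) (_ ∷ X) (_ ∷ Y) = cong (_ ∷_) (embed-∩ T X Y)
embed-∩ (inside ∷ T) X Y = cong (inside ∷_) (embed-∩ T X Y)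

-- |T ∪ Y| = |T| + |Y|, the source of the shift d ↦ d - |T| in codim.
∣embed∣ : ∀ {n} (T : Subset n) Y → ∣ embed T Y ∣ ≡ ∣ T ∣ + ∣ Y ∣
∣embed∣ [] [] = refl
∣embed∣ (outside ∷ T) (outside ∷ Y) = ∣embed∣ T Y
∣embed∣ (outside ∷ T) (inside ∷ Y) = trans (cong suc (∣embed∣ T Y)) (sym (ℕP.+-suc ∣ T ∣ ∣ Y ∣))
∣embed∣ (inside ∷ T) Y = cong suc (∣embed∣ T Y)

∣p∣≡0⇒p≡⊥ : ∀ {n} (X : Subset n) → ∣ X ∣ ≡ 0 → X ≡ ⊥
∣p∣≡0⇒p≡⊥ [] _ = refl
∣p∣≡0⇒p≡⊥ (outside ∷ X) eq = cong (outside ∷_) (∣p∣≡0⇒p≡⊥ X eq)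
∣p∣≡0⇒p≡⊥ (inside ∷ X) ()

split-injective : ∀ {n} (xs ys xs' ys' : List (Subset n)) →
  map (outside ∷_) xs ++ map (inside ∷_) ys ≡ map (outside ∷_) xs' ++ map (inside ∷_) ys' →
  xs ≡ xs' × ys ≡ ys'
split-injective [] ys [] ys' eq = refl , ListP.map-injective VecP.∷-injectiveʳ eq
split-injective (x ∷ xs) ys (x' ∷ xs') ys' eq
  with heads , tails ← ListP.∷-injective eq
  with xs≡xs' , ys≡ys' ← split-injective xs ys xs' ys' tails
  = cong₂ _∷_ (VecP.∷-injectiveʳ heads) xs≡xs' , ys≡ys'
split-injective [] [] (_ ∷ _) _ ()
split-injective [] (_ ∷ _) (_ ∷ _) _ ()
split-injective (_ ∷ _) _ [] [] ()
split-injective (_ ∷ _) _ [] (_ ∷ _) ()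

members-injective : ∀ {n} (C C' : Coll n) → members C ≡ members C' → C ≡ C'
members-injective {zero} true true _ = refl
members-injective {zero} false false _ = refl
members-injective {zero} true false ()
members-injective {zero} false true ()
members-injective {suc n} (A , B) (A' , B') eq
  with A≡A' , B≡B' ← split-injective (members A) (members B) (members A') (members B') eq
  = cong₂ _,_ (members-injective A A' A≡A') (members-injective B B' B≡B')

members-emptyC : ∀ {n} → members (emptyC {n}) ≡ []
members-emptyC {zero} = refl
members-emptyC {suc n} rewrite members-emptyC {n} = refl

members-single : ∀ {n} (X : Subset n) → members (single X) ≡ X ∷ []
members-single [] = refl
members-single {suc n} (outside ∷ X) rewrite members-single X | members-emptyC {n} = refl
members-single {suc n} (inside ∷ X) rewrite members-single X | members-emptyC {n} = refl

no-members⇒emptyC : ∀ {n} (C : Coll n) → (∀ X → ¬ X ∈C C) → C ≡ emptyC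
no-members⇒emptyC C none = members-injective C emptyC (trans (empty (members C) none) (sym members-emptyC))
  where
  empty : ∀ {n} (xs : List (Subset n)) → (∀ X → ¬ X ∈ xs) → xs ≡ []
  empty [] _ = refl
  empty (x ∷ _) none = contradiction (here refl) (none x)

∈-single : ∀ {n} (X : Subset n) → X ∈C single X
∈-single X = subst (X ∈_) (sym (members-single X)) (here refl)

∈-single⁻ : ∀ {n} {X Y : Subset n} → Y ∈C single X → Y ≡ X
∈-single⁻ {X = X} Y∈ with subst (_ ∈_) (members-single X) Y∈
... | here Y≡X = Y≡X

∈-left : ∀ {n} {A B : Coll n} {X} → X ∈C A → (outside ∷ X) ∈C (A , B)
∈-left X∈A = ∈-++⁺ˡ (∈-map⁺ (outside ∷_) X∈A)

∈-right : ∀ {n} {A B : Coll n} {X} → X ∈C B → (inside ∷ X) ∈C (A , B)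
∈-right {A = A} X∈B = ∈-++⁺ʳ (map (outside ∷_) (members A)) (∈-map⁺ (inside ∷_) X∈B)

-- Lifting collections on the complement of T to collections above T.

-- lift T C = { T ∪ Y : Y ∈ C }.
lift : ∀ {n} (T : Subset n) → Coll (free T) → Coll n
lift [] C = C
lift (outside ∷ T) (A , B) = lift T A , lift T B
lift (inside ∷ T) C = emptyC , lift T C

-- restrict T S = { Y : T ∪ Y ∈ S }, the inverse of lift on collections above T.
restrict : ∀ {n} (T : Subset n) → Coll n → Coll (free T)
restrict [] S = S
restrict (outside ∷ T) (A , B) = restrict T A , restrict T B
restrict (inside ∷ T) (_ , B) = restrict T B

Above : ∀ {n} → Subset n → Coll n → Set
Above T S = ∀ X → X ∈C S → T ⊆ X

members-lift : ∀ {n} (T : Subset n) C → members (lift T C) ≡ map (embed T) (members C)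
members-lift [] C = sym (ListP.map-id (members C))
-- The middle step uses  (b ∷_) ∘ embed T = embed (outside ∷ T) ∘ (b ∷_),
-- which holds by definition of embed.
members-lift (outside ∷ T) (A , B) = begin
    map (outside ∷_) (members (lift T A)) ++ map (inside ∷_) (members (lift T B))
  ≡⟨ cong₂ (λ xs ys → map (outside ∷_) xs ++ map (inside ∷_) ys) (members-lift T A) (members-lift T B) ⟩
    map (outside ∷_) (map (embed T) (members A)) ++ map (inside ∷_) (map (embed T) (members B))
  ≡⟨ cong₂ _++_ (sym (ListP.map-∘ (members A))) (sym (ListP.map-∘ (members B))) ⟩
    map (embed (outside ∷ T) ∘ (outside ∷_)) (members A) ++ map (embed (outside ∷ T) ∘ (inside ∷_)) (members B)
  ≡⟨ cong₂ _++_ (ListP.map-∘ (members A)) (ListP.map-∘ (members B)) ⟩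
    map (embed (outside ∷ T)) (map (outside ∷_) (members A)) ++ map (embed (outside ∷ T)) (map (inside ∷_) (members B))
  ≡⟨ sym (ListP.map-++ (embed (outside ∷ T)) (map (outside ∷_) (members A)) (map (inside ∷_) (members B))) ⟩
    map (embed (outside ∷ T)) (members (A , B))
  ∎
  where open ≡-Reasoning
members-lift {suc n} (inside ∷ T) C = begin
    map (outside ∷_) (members (emptyC {n})) ++ map (inside ∷_) (members (lift T C))
  ≡⟨ cong₂ (λ xs ys → map (outside ∷_) xs ++ map (inside ∷_) ys) members-emptyC (members-lift T C) ⟩
    map (inside ∷_) (map (embed T) (members C))
  ≡⟨ sym (ListP.map-∘ (members C)) ⟩
    map (embed (inside ∷ T)) (members C)
  ∎
  where open ≡-Reasoning

∈-lift⁺ : ∀ {n} (T : Subset n) {C Y} → Y ∈C C → embed T Y ∈C lift T C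
∈-lift⁺ T {C} Y∈C = subst (_ ∈_) (sym (members-lift T C)) (∈-map⁺ (embed T) Y∈C)

∈-lift⁻ : ∀ {n} (T : Subset n) {C X} → X ∈C lift T C → ∃ λ Y → Y ∈C C × X ≡ embed T Y
∈-lift⁻ T {C} X∈ = ∈-map⁻ (embed T) (subst (_ ∈_) (members-lift T C) X∈)

size-lift : ∀ {n} (T : Subset n) C → size (lift T C) ≡ size C
size-lift T C = trans (cong length (members-lift T C)) (ListP.length-map (embed T) (members C))

lift-above : ∀ {n} (T : Subset n) C → Above T (lift T C)
lift-above T C X X∈ with Y , _ , refl ← ∈-lift⁻ T X∈ = T⊆embed T Y

restrict-lift : ∀ {n} (T : Subset n) C → restrict T (lift T C) ≡ C
restrict-lift [] C = refl
restrict-lift (outside ∷ T) (A , B) = cong₂ _,_ (restrict-lift T A) (restrict-lift T B)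
restrict-lift (inside ∷ T) C = restrict-lift T C

lift-restrict : ∀ {n} (T : Subset n) S → Above T S → lift T (restrict T S) ≡ S
lift-restrict [] S _ = refl
lift-restrict (outside ∷ T) (A , B) above =
  cong₂ _,_ (lift-restrict T A (λ X X∈A → drop-∷-⊆ (above _ (∈-left X∈A))))
            (lift-restrict T B (λ X X∈B → drop-∷-⊆ (above _ (∈-right X∈B))))
lift-restrict (inside ∷ T) (A , B) above =
  cong₂ _,_ (sym (no-members⇒emptyC A λ X X∈A → contradiction (above _ (∈-left X∈A) here) λ ()))
            (lift-restrict T B (λ X X∈B → drop-∷-⊆ (above _ (∈-right X∈B))))

lift-emptyC : ∀ {n} (T : Subset n) → lift T emptyC ≡ emptyC
lift-emptyC [] = refl
lift-emptyC (outside ∷ T) = cong₂ _,_ (lift-emptyC T) (lift-emptyC T)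
lift-emptyC (inside ∷ T) = cong (emptyC ,_) (lift-emptyC T)

lift-single⊥ : ∀ {n} (T : Subset n) → lift T (single ⊥) ≡ single T
lift-single⊥ [] = refl
lift-single⊥ (outside ∷ T) = cong₂ _,_ (lift-single⊥ T) (lift-emptyC T)
lift-single⊥ (inside ∷ T) = cong (emptyC ,_) (lift-single⊥ T)

lift-⊆C : ∀ {n} (T : Subset n) {C C'} → C' ⊆C C → lift T C' ⊆C lift T C
lift-⊆C T C'⊆C X X∈ with Y , Y∈ , refl ← ∈-lift⁻ T X∈ = ∈-lift⁺ T (C'⊆C Y Y∈)

⊆C-lift : ∀ {n} (T : Subset n) {C} S → S ⊆C lift T C →
          Σ (Coll (free T)) λ C' → lift T C' ≡ S × C' ⊆C C
⊆C-lift T {C} S S⊆ = restrict T S , S≡ , restrict⊆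
  where
  S≡ : lift T (restrict T S) ≡ S
  S≡ = lift-restrict T S (λ X X∈S → lift-above T C X (S⊆ X X∈S))
  restrict⊆ : restrict T S ⊆C C
  restrict⊆ Y Y∈ with Y' , Y'∈C , eq ← ∈-lift⁻ T (S⊆ _ (subst (_ ∈C_) S≡ (∈-lift⁺ T Y∈)))
    = subst (_∈C C) (sym (embed-injective T eq)) Y'∈C

Σcodim : ∀ {n} → ℕ → List (Subset n) → ℤ
Σcodim d = foldr (λ X r → codim d X ℤ.+ r) (+ 0)

codim≡⊖ : ∀ {n} d (X : Subset n) → codim d X ≡ suc d ⊖ ∣ X ∣
codim≡⊖ d X = ℤP.[+m]-[+n]≡m⊖n (suc d) ∣ X ∣

codim-embed : ∀ {n} (T : Subset n) d → ∣ T ∣ ≤ d → ∀ Y → codim d (embed T Y) ≡ codim (d ∸ ∣ T ∣) Y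
codim-embed T d ∣T∣≤d Y = begin
    codim d (embed T Y)
  ≡⟨ codim≡⊖ d (embed T Y) ⟩
    suc d ⊖ ∣ embed T Y ∣
  ≡⟨ cong₂ _⊖_ suc-d≡ (∣embed∣ T Y) ⟩
    (∣ T ∣ + suc (d ∸ ∣ T ∣)) ⊖ (∣ T ∣ + ∣ Y ∣)
  ≡⟨ ℤP.+-cancelˡ-⊖ ∣ T ∣ _ _ ⟩
    suc (d ∸ ∣ T ∣) ⊖ ∣ Y ∣
  ≡⟨ sym (codim≡⊖ (d ∸ ∣ T ∣) Y) ⟩
    codim (d ∸ ∣ T ∣) Y
  ∎
  where
  open ≡-Reasoning
  suc-d≡ : suc d ≡ ∣ T ∣ + suc (d ∸ ∣ T ∣)
  suc-d≡ = trans (cong suc (sym (ℕP.m+[n∸m]≡n ∣T∣≤d))) (sym (ℕP.+-suc ∣ T ∣ (d ∸ ∣ T ∣)))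

ρ-lift : ∀ {n} (T : Subset n) d → ∣ T ∣ ≤ d → ∀ C → ρ d (lift T C) ≡ ρ (d ∸ ∣ T ∣) C
ρ-lift T d ∣T∣≤d C = trans (cong (Σcodim d) (members-lift T C)) (Σcodim-embed (members C))
  where
  Σcodim-embed : ∀ Ys → Σcodim d (map (embed T) Ys) ≡ Σcodim (d ∸ ∣ T ∣) Ys
  Σcodim-embed [] = refl
  Σcodim-embed (Y ∷ Ys) = cong₂ ℤ._+_ (codim-embed T d ∣T∣≤d Y) (Σcodim-embed Ys)

⋂-lift : ∀ {n} (T : Subset n) C → ⋂ (lift T C) ≡ embed T (⋂ C)
⋂-lift T C = trans (cong (foldr _∩_ ⊤) (members-lift T C)) (⋂-embed (members C))
  where
  ⋂-embed : ∀ Ys → foldr _∩_ ⊤ (map (embed T) Ys) ≡ embed T (foldr _∩_ ⊤ Ys)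
  ⋂-embed [] = sym (embed-⊤ T)
  ⋂-embed (Y ∷ Ys) = trans (cong (embed T Y ∩_) (⋂-embed Ys)) (sym (embed-∩ T Y _))

D-lift : ∀ {n} (T : Subset n) d → ∣ T ∣ ≤ d → ∀ C → D d (lift T C) ≡ D (d ∸ ∣ T ∣) C
D-lift T d ∣T∣≤d C =
  cong₂ ℤ._-_ (trans (cong (codim d) (⋂-lift T C)) (codim-embed T d ∣T∣≤d (⋂ C)))
              (ρ-lift T d ∣T∣≤d C)

Refines : ∀ {n} → Coll n → Coll n → Set
Refines S S' = ∀ X → X ∈C S → ∃ λ Y → Y ∈C S' × Y ⊆ X

module Transfer {n} (T : Subset n) (d : ℕ) (∣T∣≤d : ∣ T ∣ ≤ d) where

  d' : ℕ
  d' = d ∸ ∣ T ∣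

  ∣embed∣≡ : ∀ Y → ∣ embed T Y ∣ ≡ ∣ Y ∣ + ∣ T ∣
  ∣embed∣≡ Y = trans (∣embed∣ T Y) (ℕP.+-comm ∣ T ∣ ∣ Y ∣)

  -- Conditions (1) and (2) transfer since sub-collections, sizes, D and
  -- member cardinalities (shifted by |T|) correspond under lift T.
  InL-lift⁺ : ∀ C → InL (free T) d' C → InL n d (lift T C)
  InL-lift⁺ C C∈L = record { cond1 = cond1 ; cond2 = cond2 }
    where
    cond1 : ∀ S → S ⊆C lift T C → 1 ℕ.< size S → + 0 ℤ.< D d S
    cond1 S S⊆ 1<∣S∣ with C' , refl , C'⊆C ← ⊆C-lift T S S⊆ =
      subst (+ 0 ℤ.<_) (sym (D-lift T d ∣T∣≤d C'))
            (InL.cond1 C∈L C' C'⊆C (subst (1 ℕ.<_) (size-lift T C') 1<∣S∣))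
    cond2 : ∀ X → X ∈C lift T C → ∣ X ∣ ≤ d
    cond2 X X∈ with Y , Y∈C , refl ← ∈-lift⁻ T X∈ =
      subst (_≤ d) (sym (∣embed∣≡ Y)) (ℕP.m≤o∸n⇒m+n≤o ∣ Y ∣ ∣T∣≤d (InL.cond2 C∈L Y Y∈C))

  InL-lift⁻ : ∀ C → InL n d (lift T C) → InL (free T) d' C
  InL-lift⁻ C liftC∈L = record { cond1 = cond1 ; cond2 = cond2 }
    where
    cond1 : ∀ C' → C' ⊆C C → 1 ℕ.< size C' → + 0 ℤ.< D d' C'
    cond1 C' C'⊆C 1<∣C'∣ =
      subst (+ 0 ℤ.<_) (D-lift T d ∣T∣≤d C')
            (InL.cond1 liftC∈L (lift T C') (lift-⊆C T C'⊆C) (subst (1 ℕ.<_) (sym (size-lift T C')) 1<∣C'∣))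
    cond2 : ∀ Y → Y ∈C C → ∣ Y ∣ ≤ d'
    cond2 Y Y∈C = ℕP.m+n≤o⇒m≤o∸n ∣ Y ∣ (subst (_≤ d) (∣embed∣≡ Y) (InL.cond2 liftC∈L (embed T Y) (∈-lift⁺ T Y∈C)))

  refines-lift⁺ : ∀ C C' → Refines C C' → Refines (lift T C) (lift T C')
  refines-lift⁺ C C' refines X X∈ with Y , Y∈C , refl ← ∈-lift⁻ T X∈
                                  with Z , Z∈C' , Z⊆Y ← refines Y Y∈C
    = embed T Z , ∈-lift⁺ T Z∈C' , embed-⊆ T Z⊆Y

  refines-lift⁻ : ∀ C C' → Refines (lift T C) (lift T C') → Refines C C'
  refines-lift⁻ C C' refines Y Y∈C with W , W∈ , W⊆ ← refines (embed T Y) (∈-lift⁺ T Y∈C)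
                                   with Z , Z∈C' , refl ← ∈-lift⁻ T W∈
    = Z , Z∈C' , embed-⊆⁻ T W⊆

  lift-mono : ∀ C C' → C ≤[ d' ] C' → lift T C ≤[ d ] lift T C'
  lift-mono C C' (inj₂ refl) = inj₂ refl
  lift-mono C C' (inj₁ (ρ< , refines)) =
    inj₁ (subst₂ ℤ._<_ (sym (ρ-lift T d ∣T∣≤d C)) (sym (ρ-lift T d ∣T∣≤d C')) ρ< , refines-lift⁺ C C' refines)

  lift-reflect : ∀ C C' → lift T C ≤[ d ] lift T C' → C ≤[ d' ] C'
  lift-reflect C C' (inj₂ eq) =
    inj₂ (trans (sym (restrict-lift T C)) (trans (cong (restrict T) eq) (restrict-lift T C')))
  lift-reflect C C' (inj₁ (ρ< , refines)) =
    inj₁ (subst₂ ℤ._<_ (ρ-lift T d ∣T∣≤d C) (ρ-lift T d ∣T∣≤d C') ρ< , refines-lift⁻ C C' refines)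

-- {∅} is the top element of every L(m,e).

ρ-single : ∀ {m} e (X : Subset m) → ρ e (single X) ≡ codim e X
ρ-single e X = trans (cong (Σcodim e) (members-single X)) (ℤP.+-identityʳ (codim e X))

ρ-single⊥ : ∀ {m} e → ρ e (single (⊥ {m})) ≡ + suc e
ρ-single⊥ {m} e = begin
    ρ e (single (⊥ {m})) ≡⟨ ρ-single e (⊥ {m}) ⟩
    codim e (⊥ {m})      ≡⟨ codim≡⊖ e (⊥ {m}) ⟩
    suc e ⊖ ∣ ⊥ {m} ∣    ≡⟨ cong (suc e ⊖_) (∣⊥∣≡0 m) ⟩
    + suc e              ∎
  where open ≡-Reasoning

codim≤ : ∀ {m} e (X : Subset m) → codim e X ℤ.≤ + suc e
codim≤ e X = subst (ℤ._≤ + suc e) (sym (codim≡⊖ e X)) (ℤP.m⊖n≤m (suc e) ∣ X ∣)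

0<i-j⇒j<i : ∀ {i j} → + 0 ℤ.< i ℤ.- j → j ℤ.< i
0<i-j⇒j<i {i} {j} 0<i-j = begin-strict
    j                           ≡⟨ sym (ℤP.+-identityˡ j) ⟩
    + 0 ℤ.+ j                   <⟨ ℤP.+-monoˡ-< j 0<i-j ⟩
    (i ℤ.- j) ℤ.+ j             ≡⟨ ℤP.+-assoc i (ℤ.- j) j ⟩
    i ℤ.+ (ℤ.- j ℤ.+ j)         ≡⟨ cong (ℤ._+_ i) (ℤP.+-inverseˡ j) ⟩
    i ℤ.+ + 0                   ≡⟨ ℤP.+-identityʳ i ⟩
    i                           ∎
  where open ℤP.≤-Reasoning

⊥-or-codim< : ∀ {m} e (Y : Subset m) → Y ≡ ⊥ ⊎ codim e Y ℤ.< + suc e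
⊥-or-codim< e Y with ∣ Y ∣ ℕP.≟ 0
... | yes ∣Y∣≡0 = inj₁ (∣p∣≡0⇒p≡⊥ Y ∣Y∣≡0)
... | no ∣Y∣≢0 =
  inj₂ (subst (ℤ._< + suc e) (sym (codim≡⊖ e Y)) (ℤP.m⊖1+n<m (suc e) ∣ Y ∣ {{ℕ.≢-nonZero ∣Y∣≢0}}))

-- With two or more members, condition (1) gives ρ_e(C) < codim_e(⋂ C) ≤ e + 1.
ρ<top-many : ∀ {m} e (C : Coll m) → InL m e C → 1 ℕ.< size C → ρ e C ℤ.< + suc e
ρ<top-many e C C∈L 1<∣C∣ =
  ℤP.<-≤-trans (0<i-j⇒j<i (InL.cond1 C∈L C (λ _ X∈C → X∈C) 1<∣C∣)) (codim≤ e (⋂ C))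

-- Every C ∈ L(m,e) other than {∅} has ρ_e(C) < ρ_e({∅}), by the number
-- of members of C (none, one, or at least two).
top-of-L : ∀ {m} e (C : Coll m) → InL m e C → C ≡ single ⊥ ⊎ ρ e C ℤ.< ρ e (single (⊥ {m}))
top-of-L {m} e C C∈L = map₂ (subst (ρ e C ℤ.<_) (sym (ρ-single⊥ {m} e))) (by-members (members C) refl)
  where
  by-members : ∀ Ys → members C ≡ Ys → C ≡ single ⊥ ⊎ ρ e C ℤ.< + suc e
  by-members [] eq = inj₂ (subst (ℤ._< + suc e) (sym (cong (Σcodim e) eq)) (+<+ (s≤s z≤n)))
  by-members (Y ∷ []) eq = map-⊎ C≡single ρ< (⊥-or-codim< e Y)
    where
    C≡single : Y ≡ ⊥ → C ≡ single ⊥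
    C≡single refl = members-injective C (single ⊥) (trans eq (sym (members-single ⊥)))
    ρ< : codim e Y ℤ.< + suc e → ρ e C ℤ.< + suc e
    ρ< = subst (ℤ._< + suc e) (sym (trans (cong (Σcodim e) eq) (ℤP.+-identityʳ (codim e Y))))
  by-members (_ ∷ _ ∷ _) eq =
    inj₂ (ρ<top-many e C C∈L (subst (λ Ys → 1 ℕ.< length Ys) (sym eq) (s≤s (s≤s z≤n))))

-- The interval below {T}.

below-single⇒above : ∀ {n d} (T : Subset n) S → S ≤[ d ] single T → Above T S
below-single⇒above T S (inj₂ refl) X X∈ = ⊆-reflexive (sym (∈-single⁻ X∈))
below-single⇒above T S (inj₁ (_ , refines)) X X∈ with Y , Y∈ , Y⊆X ← refines X X∈ =
  subst (_⊆ X) (∈-single⁻ Y∈) Y⊆X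

module Interval {n} (T : Subset n) (d : ℕ) (∣T∣≤d : ∣ T ∣ ≤ d) where
  open Transfer T d ∣T∣≤d

  -- Since {∅} is the top of L(free T, d') and lift T {∅} = {T}, every lift
  -- of an element of L(free T, d') lies below {T}.
  lift-below-single : ∀ C → InL (free T) d' C → lift T C ≤[ d ] single T
  lift-below-single C C∈L with top-of-L d' C C∈L
  ... | inj₁ refl = inj₂ (lift-single⊥ T)
  ... | inj₂ ρ< = inj₁ (subst₂ ℤ._<_ (sym (ρ-lift T d ∣T∣≤d C)) ρ⊥≡ρT ρ< , refines)
    where
    ρ⊥≡ρT : ρ d' (single (⊥ {free T})) ≡ ρ d (single T)
    ρ⊥≡ρT = trans (sym (ρ-lift T d ∣T∣≤d (single ⊥))) (cong (ρ d) (lift-single⊥ T))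
    refines : Refines (lift T C) (single T)
    refines X X∈ = T , ∈-single T , lift-above T C X X∈

  lift-restrict-below : (x : Ielt n d (single T)) → lift T (restrict T (proj₁ x)) ≡ proj₁ x
  lift-restrict-below (S , _ , S≤T) = lift-restrict T S (below-single⇒above T S S≤T)

  interval-iso : PosetIso n d (single T) (free T) d'
  interval-iso = record
    { to = λ x → restrict T (proj₁ x) ,
                 InL-lift⁻ _ (subst (InL n d) (sym (lift-restrict-below x)) (proj₁ (proj₂ x)))
    ; from = λ (C , C∈L) → lift T C , InL-lift⁺ C C∈L , lift-below-single C C∈L
    ; from∘to = lift-restrict-below
    ; to∘from = λ (C , _) → restrict-lift T C
    ; mono = λ x x' x≤x' → lift-reflect _ _
               (subst₂ _≤[ d ]_ (sym (lift-restrict-below x)) (sym (lift-restrict-below x')) x≤x')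
    ; reflect = λ x x' rx≤rx' →
                  subst₂ _≤[ d ]_ (lift-restrict-below x) (lift-restrict-below x') (lift-mono _ _ rx≤rx')
    }

-- Lemma 3.2.
lemma3p2 : (d n : ℕ) → 1 ≤ d → d < n → (T₁ : Subset n) → InL n d (single T₁) →
    PosetIso n d (single T₁) (n ∸ ∣ T₁ ∣) (d ∸ ∣ T₁ ∣)
lemma3p2 d n _ _ T₁ single∈L =
  subst (λ m → PosetIso n d (single T₁) m (d ∸ ∣ T₁ ∣)) (free≡n∸∣T∣ T₁) interval-iso
  where
  open Interval T₁ d (InL.cond2 single∈L T₁ (∈-single T₁))
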